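{- Let $k\geq p\geq 0$ be integers and $n\geq 2k-p+2$. Let $G=(X,Y;E)$ be an $(n+p+1)$-closed nearly balanced bipartite graph of order $2n-1$ (so $|X|=n$, $|Y|=n-1$). If $$e(G)>n(n-k+p-2)+(k+2)(k-p+1),$$ then $G$ contains a complete bipartite subgraph of order $2n-k+p-1$. Furthermore, if $\delta(G)\geq k$, then $G$ contains $K_{n-1,n-k+p}$ or $K_{n,n-k+p-1}$ as a subgraph.
   Context: A bipartite graph $G=(X,Y;E)$ is nearly balanced if $|X|=|Y|+1$. $G$ is $r$-closed if $d_G(x)+d_G(y)<r$ for every non-adjacent pair $x\in X$, $y\in Y$. $e(G)$ is the number of edges, $\delta(G)$ the minimum degree. -}

module Defs where

open import Data.Nat using (ℕ; _+_; _<_; _≤_)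
open import Data.Bool using (Bool; true; false)
open import Data.Fin using (Fin)
open import Data.Vec using (tabulate)
open import Data.Vec using () renaming (sum to vsum)
open import Data.Fin.Subset using (Subset; _∈_; ∣_∣)
open import Data.Product using (Σ; _×_)
open import Data.Sum using (_⊎_)
open import Relation.Binary.PropositionalEquality using (_≡_)

-- A bipartite graph G = (X, Y; E) with X = Fin a, Y = Fin b;
-- E x y ≡ true iff x ∈ X and y ∈ Y are adjacent.
BipGraph : ℕ → ℕ → Set
BipGraph a b = Fin a → Fin b → Bool

module _ {a b : ℕ} (E : BipGraph a b) where

  degX : Fin a → ℕ
  degX x = ∣ tabulate (λ y → E x y) ∣

  degY : Fin b → ℕ
  degY y = ∣ tabulate (λ x → E x y) ∣

  edges : ℕ
  edges = vsum (tabulate degX)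

  Closed : ℕ → Set
  Closed r = ∀ x y → E x y ≡ false → degX x + degY y < r

  MinDegGE : ℕ → Set
  MinDegGE k = (∀ x → k ≤ degX x) × (∀ y → k ≤ degY y)

  Complete : Subset a → Subset b → Set
  Complete A B = ∀ x y → x ∈ A → y ∈ B → E x y ≡ true

  HasCompleteOfOrder : ℕ → Set
  HasCompleteOfOrder m =
    Σ (Subset a) λ A → Σ (Subset b) λ B → (∣ A ∣ + ∣ B ∣ ≡ m) × Complete A B

  HasKXY : ℕ → ℕ → Set
  HasKXY s t = Σ (Subset a) λ A → Σ (Subset b) λ B →
    (∣ A ∣ ≡ s) × (∣ B ∣ ≡ t) × Complete A B

  HasK : ℕ → ℕ → Set
  HasK s t = HasKXY s t ⊎ HasKXY t s

module Submission where

-- Let R be the bipartite complement of G. Closedness says that every edge of R has degree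
-- sum at least D = n - 1 - p, and the edge bound says e(R) < c (D - c) for c = k - p + 1.
-- Such a graph has a vertex cover with fewer than c vertices: take an edge x₀y₀ whose
-- endpoint y₀ has the larger degree h. If h ≥ D - c, delete y₀ and induct on c; otherwise
-- every neighbour of y₀ has degree at least D - h, so e(R) ≥ h (D - h) ≥ c (D - c) by
-- concavity. G is complete between the complements of the two parts of the cover, which
-- yields the complete subgraph of order 2n - 1 - (k - p). If moreover δ(G) ≥ k and some
-- y outside the cover has an R-neighbour x, then all R-neighbours of y lie in the cover,
-- and closedness at xy gives d_R(y) ≥ k - p; so one part of the cover is empty, which
-- yields K_{n-1,n-k+p} or K_{n,n-k+p-1}.

open import Defs
open import Data.Nat using (ℕ; _+_; _*_; _∸_; _≤_; _<_)
open import Data.Product using (_×_)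
open import Data.Sum using (_⊎_)
open import Data.Nat using (zero; suc; pred; z≤n; s≤s; s≤s⁻¹; _≤?_)
open import Data.Nat.Properties hiding (_≟_)
open import Data.Nat.Tactic.RingSolver using (solve-∀)
open import Data.Bool using (Bool; true; false; not)
import Data.Bool.Properties as Bool
open import Data.Fin using (Fin; zero; suc; _≟_)
open import Data.Fin.Properties using (any?)
open import Data.Fin.Subset using (Subset; _∈_; _∉_; _⊆_; ∣_∣; ∁; ⊥; _∪_; ⁅_⁆; inside; outside; _-_)
open import Data.Fin.Subset.Properties
  using (∣p∣≤n; ∣∁p∣≡n∸∣p∣; ∣⊥∣≡0; ⊥⊆; ⊆-refl; s⊆s; x∈⁅x⁆; ∣⁅x⁆∣≡1; x∈p∪q⁺; _∈?_;
         p⊆q⇒∣p∣≤∣q∣; x∈p⇒∣p-x∣<∣p∣; x∈∁p⇒x∉p)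
open import Data.Vec using ([]; _∷_; tabulate)
open import Data.Vec using () renaming (sum to vsum)
open import Data.Vec.Properties using (lookup∘tabulate; []=⇒lookup; tabulate-cong)
open import Data.Vec.Functional using (Vector; updateAt)
open import Data.Vec.Functional.Properties using (updateAt-updates; updateAt-minimal; map-updateAt)
open import Algebra.Properties.Semiring.Sum +-*-semiring
  using (sum; sum-syntax; sum-cong-≗; ∑-distrib-+; ∑-comm; *-distribʳ-sum)
open import Data.Product using (Σ-syntax; _,_)
open import Data.Sum using (inj₁; inj₂; [_,_]′)
import Data.Sum as Sum
open import Data.Empty using (⊥-elim)
open import Function using (_∘_; id; const; flip)
open import Relation.Nullary using (yes; no; contradiction; ¬?)
open import Relation.Nullary.Decidable using (_×-dec_)
open import Relation.Binary.PropositionalEquality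

variable
  a b n : ℕ

𝟙 : Bool → ℕ
𝟙 true = 1
𝟙 false = 0

∣tabulate∣≡∑𝟙 : (f : Fin n → Bool) → ∣ tabulate f ∣ ≡ ∑[ i < n ] 𝟙 (f i)
∣tabulate∣≡∑𝟙 {zero} f = refl
∣tabulate∣≡∑𝟙 {suc n} f with f zero
... | true = cong suc (∣tabulate∣≡∑𝟙 (f ∘ suc))
... | false = ∣tabulate∣≡∑𝟙 (f ∘ suc)

∣tabulate-not∣+∣tabulate∣≡n : (f : Fin n → Bool) → ∣ tabulate (not ∘ f) ∣ + ∣ tabulate f ∣ ≡ n
∣tabulate-not∣+∣tabulate∣≡n {zero} f = refl
∣tabulate-not∣+∣tabulate∣≡n {suc n} f with f zero
... | true = trans (+-suc _ _) (cong suc (∣tabulate-not∣+∣tabulate∣≡n (f ∘ suc)))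
... | false = cong suc (∣tabulate-not∣+∣tabulate∣≡n (f ∘ suc))

∈-tabulate⁻ : (f : Fin n → Bool) {i : Fin n} → i ∈ tabulate f → f i ≡ true
∈-tabulate⁻ f {i} i∈ = trans (sym (lookup∘tabulate f i)) ([]=⇒lookup i∈)

vsum∘tabulate≡∑ : (f : Fin n → ℕ) → vsum (tabulate f) ≡ sum f
vsum∘tabulate≡∑ {zero} f = refl
vsum∘tabulate≡∑ {suc n} f = cong (f zero +_) (vsum∘tabulate≡∑ (f ∘ suc))

∑-const : ∀ n c → ∑[ i < n ] c ≡ n * c
∑-const zero c = refl
∑-const (suc n) c = cong (c +_) (∑-const n c)

∑-mono-≤ : {f g : Fin n → ℕ} → (∀ i → f i ≤ g i) → sum f ≤ sum g
∑-mono-≤ {zero} f≤g = z≤n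
∑-mono-≤ {suc n} f≤g = +-mono-≤ (f≤g zero) (∑-mono-≤ (f≤g ∘ suc))

sum-updateAt-zero : (f : Vector ℕ n) (i : Fin n) → sum f ≡ f i + sum (updateAt f i (const 0))
sum-updateAt-zero f zero = refl
sum-updateAt-zero {suc n} f (suc i) = begin
  f zero + sum (f ∘ suc)                                 ≡⟨ cong (f zero +_) (sum-updateAt-zero (f ∘ suc) i) ⟩
  f zero + (f (suc i) + sum (updateAt (f ∘ suc) i _))    ≡⟨ +-comm-middle (f zero) (f (suc i)) _ ⟩
  f (suc i) + (f zero + sum (updateAt (f ∘ suc) i _))    ∎
  where
  open ≡-Reasoning
  +-comm-middle : ∀ x y z → x + (y + z) ≡ y + (x + z)
  +-comm-middle = solve-∀

∣p∪q∣≤∣p∣+∣q∣ : (p q : Subset n) → ∣ p ∪ q ∣ ≤ ∣ p ∣ + ∣ q ∣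
∣p∪q∣≤∣p∣+∣q∣ [] [] = z≤n
∣p∪q∣≤∣p∣+∣q∣ (outside ∷ p) (outside ∷ q) = ∣p∪q∣≤∣p∣+∣q∣ p q
∣p∪q∣≤∣p∣+∣q∣ (outside ∷ p) (inside ∷ q) =
  ≤-trans (s≤s (∣p∪q∣≤∣p∣+∣q∣ p q)) (≤-reflexive (sym (+-suc ∣ p ∣ ∣ q ∣)))
∣p∪q∣≤∣p∣+∣q∣ (inside ∷ p) (outside ∷ q) = s≤s (∣p∪q∣≤∣p∣+∣q∣ p q)
∣p∪q∣≤∣p∣+∣q∣ (inside ∷ p) (inside ∷ q) =
  s≤s (≤-trans (m≤n⇒m≤1+n (∣p∪q∣≤∣p∣+∣q∣ p q)) (≤-reflexive (sym (+-suc ∣ p ∣ ∣ q ∣))))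

∣∁p∣+∣p∣≡n : (p : Subset n) → ∣ ∁ p ∣ + ∣ p ∣ ≡ n
∣∁p∣+∣p∣≡n p = trans (cong (_+ ∣ p ∣) (∣∁p∣≡n∸∣p∣ p)) (m∸n+n≡m (∣p∣≤n p))

n+∣⊥∣≤n : ∀ n → n + ∣ ⊥ {n} ∣ ≤ n
n+∣⊥∣≤n n = ≤-reflexive (trans (cong (n +_) (∣⊥∣≡0 n)) (+-identityʳ n))

∣p∣≡0⇒x∉p : {p : Subset n} {x : Fin n} → ∣ p ∣ ≡ 0 → x ∉ p
∣p∣≡0⇒x∉p {p = p} {x} ∣p∣≡0 x∈p = contradiction (subst (∣ p - x ∣ <_) ∣p∣≡0 (x∈p⇒∣p-x∣<∣p∣ x∈p)) λ ()

⊆-ofSize : (p : Subset n) {t : ℕ} → t ≤ ∣ p ∣ → Σ[ q ∈ Subset n ] q ⊆ p × ∣ q ∣ ≡ t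
⊆-ofSize {n} p {zero} _ = ⊥ , ⊥⊆ , ∣⊥∣≡0 n
⊆-ofSize (outside ∷ p) {suc t} t<∣p∣ =
  let q , q⊆p , ∣q∣≡t = ⊆-ofSize p t<∣p∣ in outside ∷ q , s⊆s q⊆p , ∣q∣≡t
⊆-ofSize (inside ∷ p) {suc t} t<∣p∣ =
  let q , q⊆p , ∣q∣≡t = ⊆-ofSize p (s≤s⁻¹ t<∣p∣) in inside ∷ q , s⊆s q⊆p , cong suc ∣q∣≡t

⊆-splitSize : (p : Subset a) (q : Subset b) {t : ℕ} → t ≤ ∣ p ∣ + ∣ q ∣ →
  Σ[ p′ ∈ Subset a ] Σ[ q′ ∈ Subset b ] p′ ⊆ p × q′ ⊆ q × ∣ p′ ∣ + ∣ q′ ∣ ≡ t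
⊆-splitSize {b = b} p q {t} t≤ with ∣ p ∣ ≤? t
... | yes ∣p∣≤t =
  let q′ , q′⊆q , ∣q′∣≡ = ⊆-ofSize q (m≤n+o⇒m∸n≤o t ∣ p ∣ t≤) in
  p , q′ , ⊆-refl , q′⊆q , trans (cong (∣ p ∣ +_) ∣q′∣≡) (m+[n∸m]≡n ∣p∣≤t)
... | no ∣p∣≰t =
  let p′ , p′⊆p , ∣p′∣≡ = ⊆-ofSize p (≰⇒≥ ∣p∣≰t) in
  p′ , ⊥ , p′⊆p , ⊥⊆ , trans (cong (∣ p′ ∣ +_) (∣⊥∣≡0 b)) (trans (+-identityʳ _) ∣p′∣≡)

complement : BipGraph a b → BipGraph a b
complement G x y = not (G x y)

deleteY : BipGraph a b → Fin b → BipGraph a b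
deleteY R y₀ x = updateAt (R x) y₀ (const false)

DegreeSumAtLeast : BipGraph a b → ℕ → Set
DegreeSumAtLeast R D = ∀ x y → R x y ≡ true → D ≤ degX R x + degY R y

Covers : BipGraph a b → Subset a → Subset b → Set
Covers R CX CY = ∀ x y → R x y ≡ true → x ∈ CX ⊎ y ∈ CY

HasVertexCoverBelow : BipGraph a b → ℕ → Set
HasVertexCoverBelow {a} {b} R c =
  Σ[ CX ∈ Subset a ] Σ[ CY ∈ Subset b ] Covers R CX CY × ∣ CX ∣ + ∣ CY ∣ < c

edges≡∑degX : (R : BipGraph a b) → edges R ≡ ∑[ x < a ] degX R x
edges≡∑degX R = vsum∘tabulate≡∑ (degX R)

edges≡∑degY : (R : BipGraph a b) → edges R ≡ ∑[ y < b ] degY R y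
edges≡∑degY {a} {b} R = begin
  edges R                                   ≡⟨ edges≡∑degX R ⟩
  ∑[ x < a ] degX R x                       ≡⟨ sum-cong-≗ (λ x → ∣tabulate∣≡∑𝟙 (R x)) ⟩
  ∑[ x < a ] ∑[ y < b ] 𝟙 (R x y)           ≡⟨ ∑-comm (λ x y → 𝟙 (R x y)) ⟩
  ∑[ y < b ] ∑[ x < a ] 𝟙 (R x y)           ≡⟨ sum-cong-≗ (λ y → ∣tabulate∣≡∑𝟙 (λ x → R x y)) ⟨
  ∑[ y < b ] degY R y                       ∎
  where open ≡-Reasoning

edges-flip : (R : BipGraph a b) → edges (flip R) ≡ edges R
edges-flip R = trans (edges≡∑degX (flip R)) (sym (edges≡∑degY R))

edges-complement : (G : BipGraph a b) → edges (complement G) + edges G ≡ a * b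
edges-complement {a} {b} G = begin
  edges (complement G) + edges G                        ≡⟨ cong₂ _+_ (edges≡∑degX (complement G)) (edges≡∑degX G) ⟩
  ∑[ x < a ] degX (complement G) x + ∑[ x < a ] degX G x ≡⟨ ∑-distrib-+ (degX (complement G)) (degX G) ⟨
  ∑[ x < a ] (degX (complement G) x + degX G x)          ≡⟨ sum-cong-≗ (λ x → ∣tabulate-not∣+∣tabulate∣≡n (G x)) ⟩
  ∑[ x < a ] b                                           ≡⟨ ∑-const a b ⟩
  a * b                                                  ∎
  where open ≡-Reasoning

degX-deleteY : (R : BipGraph a b) (y₀ : Fin b) (x : Fin a) → degX R x ≡ 𝟙 (R x y₀) + degX (deleteY R y₀) x
degX-deleteY R y₀ x = begin
  degX R x                                             ≡⟨ ∣tabulate∣≡∑𝟙 (R x) ⟩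
  sum (𝟙 ∘ R x)                                        ≡⟨ sum-updateAt-zero (𝟙 ∘ R x) y₀ ⟩
  𝟙 (R x y₀) + sum (updateAt (𝟙 ∘ R x) y₀ (const 0))   ≡⟨ cong (𝟙 (R x y₀) +_) (sum-cong-≗ (map-updateAt {f = 𝟙} {g = const false} (λ _ → refl) (R x) y₀)) ⟨
  𝟙 (R x y₀) + sum (𝟙 ∘ deleteY R y₀ x)                ≡⟨ cong (𝟙 (R x y₀) +_) (∣tabulate∣≡∑𝟙 (deleteY R y₀ x)) ⟨
  𝟙 (R x y₀) + degX (deleteY R y₀) x                   ∎
  where open ≡-Reasoning

edges-deleteY : (R : BipGraph a b) (y₀ : Fin b) → edges R ≡ degY R y₀ + edges (deleteY R y₀)
edges-deleteY {a} R y₀ = begin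
  edges R                                                        ≡⟨ edges≡∑degX R ⟩
  ∑[ x < a ] degX R x                                            ≡⟨ sum-cong-≗ (degX-deleteY R y₀) ⟩
  ∑[ x < a ] (𝟙 (R x y₀) + degX (deleteY R y₀) x)                ≡⟨ ∑-distrib-+ (λ x → 𝟙 (R x y₀)) _ ⟩
  ∑[ x < a ] 𝟙 (R x y₀) + ∑[ x < a ] degX (deleteY R y₀) x       ≡⟨ cong₂ _+_ (∣tabulate∣≡∑𝟙 (λ x → R x y₀)) (edges≡∑degX (deleteY R y₀)) ⟨
  degY R y₀ + edges (deleteY R y₀)                               ∎
  where open ≡-Reasoning

Closed⇒DegreeSumAtLeast-complement : (G : BipGraph a b) {r D : ℕ} → r + D ≡ suc (a + b) →
  Closed G r → DegreeSumAtLeast (complement G) D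
Closed⇒DegreeSumAtLeast-complement {a} {b} G {r} {D} r+D≡ closed x y nonedge =
  +-cancelʳ-≤ (suc (dX + dY)) D (hX + hY) (begin
    D + suc (dX + dY)          ≤⟨ +-monoʳ-≤ D (closed x y (trans (sym (Bool.not-involutive (G x y))) (cong not nonedge))) ⟩
    D + r                      ≡⟨ trans (+-comm D r) r+D≡ ⟩
    suc (a + b)                ≡⟨ cong suc (cong₂ _+_ (∣tabulate-not∣+∣tabulate∣≡n (λ x → G x y)) (∣tabulate-not∣+∣tabulate∣≡n (G x))) ⟨
    suc (hY + dY + (hX + dX))  ≡⟨ regroup hY dY hX dX ⟩
    hX + hY + suc (dX + dY)    ∎)
  where
  open ≤-Reasoning
  hX = degX (complement G) x
  hY = degY (complement G) y
  dX = degX G x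
  dY = degY G y
  regroup : ∀ hY dY hX dX → suc (hY + dY + (hX + dX)) ≡ hX + hY + suc (dX + dY)
  regroup = solve-∀

deleteY-edge : (R : BipGraph a b) {y₀ : Fin b} {x : Fin a} {y : Fin b} → deleteY R y₀ x y ≡ true →
  y ≢ y₀ × R x y ≡ true
deleteY-edge R {y₀} {x} {y} edge = y≢y₀ , trans (sym (updateAt-minimal y y₀ (R x) y≢y₀)) edge
  where
  y≢y₀ : y ≢ y₀
  y≢y₀ refl = contradiction (trans (sym edge) (updateAt-updates y₀ (R x))) λ ()

degY-deleteY : (R : BipGraph a b) {y₀ y : Fin b} → y ≢ y₀ → degY (deleteY R y₀) y ≡ degY R y
degY-deleteY R {y₀} {y} y≢y₀ = cong ∣_∣ (tabulate-cong λ x → updateAt-minimal y y₀ (R x) y≢y₀)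

degX≤1+degX-deleteY : (R : BipGraph a b) (y₀ : Fin b) (x : Fin a) → degX R x ≤ suc (degX (deleteY R y₀) x)
degX≤1+degX-deleteY R y₀ x = ≤-trans (≤-reflexive (degX-deleteY R y₀ x)) (+-monoˡ-≤ _ (𝟙≤1 (R x y₀)))
  where
  𝟙≤1 : ∀ β → 𝟙 β ≤ 1
  𝟙≤1 true = ≤-refl
  𝟙≤1 false = z≤n

DegreeSumAtLeast-deleteY : (R : BipGraph a b) (y₀ : Fin b) {D : ℕ} →
  DegreeSumAtLeast R (suc D) → DegreeSumAtLeast (deleteY R y₀) D
DegreeSumAtLeast-deleteY R y₀ {D} deg x y edge with deleteY-edge R edge
... | y≢y₀ , edgeR = s≤s⁻¹ (begin
  suc D                                  ≤⟨ deg x y edgeR ⟩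
  degX R x + degY R y                    ≤⟨ +-monoˡ-≤ (degY R y) (degX≤1+degX-deleteY R y₀ x) ⟩
  suc (degX R′ x) + degY R y             ≡⟨ cong (suc (degX R′ x) +_) (degY-deleteY R y≢y₀) ⟨
  suc (degX R′ x + degY R′ y)            ∎)
  where
  open ≤-Reasoning
  R′ = deleteY R y₀

HasVertexCoverBelow-deleteY : (R : BipGraph a b) (y₀ : Fin b) {c : ℕ} →
  HasVertexCoverBelow (deleteY R y₀) c → HasVertexCoverBelow R (suc c)
HasVertexCoverBelow-deleteY R y₀ (CX , CY , covers , small) =
  CX , CY ∪ ⁅ y₀ ⁆ , covers′ , s≤s (begin
    ∣ CX ∣ + ∣ CY ∪ ⁅ y₀ ⁆ ∣          ≤⟨ +-monoʳ-≤ ∣ CX ∣ (∣p∪q∣≤∣p∣+∣q∣ CY ⁅ y₀ ⁆) ⟩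
    ∣ CX ∣ + (∣ CY ∣ + ∣ ⁅ y₀ ⁆ ∣)    ≡⟨ cong (λ s → ∣ CX ∣ + (∣ CY ∣ + s)) (∣⁅x⁆∣≡1 y₀) ⟩
    ∣ CX ∣ + (∣ CY ∣ + 1)            ≡⟨ trans (cong (∣ CX ∣ +_) (+-comm ∣ CY ∣ 1)) (+-suc ∣ CX ∣ ∣ CY ∣) ⟩
    suc (∣ CX ∣ + ∣ CY ∣)            ≤⟨ small ⟩
    _                                ∎)
  where
  open ≤-Reasoning
  covers′ : Covers R CX (CY ∪ ⁅ y₀ ⁆)
  covers′ x y edge with y ≟ y₀
  ... | yes refl = inj₂ (x∈p∪q⁺ (inj₂ (x∈⁅x⁆ y₀)))
  ... | no y≢y₀ = Sum.map₂ (x∈p∪q⁺ ∘ inj₁)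
    (covers x y (trans (updateAt-minimal y y₀ (R x) y≢y₀) edge))

HasVertexCoverBelow-flip : (R : BipGraph a b) {c : ℕ} → HasVertexCoverBelow (flip R) c → HasVertexCoverBelow R c
HasVertexCoverBelow-flip R {c} (CY , CX , covers , small) =
  CX , CY , (λ x y edge → Sum.swap (covers y x edge)) , subst (_< c) (+-comm ∣ CY ∣ ∣ CX ∣) small

degY*m≤edges : (R : BipGraph a b) (y : Fin b) {m : ℕ} → (∀ x → R x y ≡ true → m ≤ degX R x) →
  degY R y * m ≤ edges R
degY*m≤edges {a} R y {m} large = begin
  degY R y * m                   ≡⟨ cong (_* m) (∣tabulate∣≡∑𝟙 (λ x → R x y)) ⟩
  (∑[ x < a ] 𝟙 (R x y)) * m     ≡⟨ *-distribʳ-sum m (λ x → 𝟙 (R x y)) ⟩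
  ∑[ x < a ] (𝟙 (R x y) * m)     ≤⟨ ∑-mono-≤ term≤degX ⟩
  ∑[ x < a ] degX R x            ≡⟨ edges≡∑degX R ⟨
  edges R                        ∎
  where
  open ≤-Reasoning
  term≤degX : ∀ x → 𝟙 (R x y) * m ≤ degX R x
  term≤degX x with R x y in edge
  ... | true = ≤-trans (≤-reflexive (+-identityʳ m)) (large x edge)
  ... | false = z≤n

u≤h≤v⇒u*v≤h*[u+v∸h] : {u h v : ℕ} → u ≤ h → h ≤ v → u * v ≤ h * (u + v ∸ h)
u≤h≤v⇒u*v≤h*[u+v∸h] {u} u≤h h≤v with m≤n⇒∃[o]m+o≡n u≤h
... | s , refl with m≤n⇒∃[o]m+o≡n h≤v
... | w , refl = begin
  u * (u + s + w)                    ≤⟨ m≤m+n _ (s * w) ⟩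
  u * (u + s + w) + s * w            ≡⟨ expand u s w ⟩
  (u + s) * (u + w)                  ≡⟨ cong ((u + s) *_) (m+n∸m≡n (u + s) (u + w)) ⟨
  (u + s) * (u + s + (u + w) ∸ (u + s)) ≡⟨ cong (λ t → (u + s) * (t ∸ (u + s))) (regroup u s w) ⟩
  (u + s) * (u + (u + s + w) ∸ (u + s)) ∎
  where
  open ≤-Reasoning
  expand : ∀ u s w → u * (u + s + w) + s * w ≡ (u + s) * (u + w)
  expand = solve-∀
  regroup : ∀ u s w → u + s + (u + w) ≡ u + (u + s + w)
  regroup = solve-∀

light-edge⇒many-edges : (R : BipGraph a b) {c e : ℕ} {x₀ : Fin a} {y₀ : Fin b} → c ≤ e →
  DegreeSumAtLeast R (suc c + e) → R x₀ y₀ ≡ true → degX R x₀ ≤ degY R y₀ → degY R y₀ < e →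
  suc c * e ≤ edges R
light-edge⇒many-edges R {c} {e} {x₀} {y₀} c≤e deg edge x₀≤y₀ y₀<e = begin
  suc c * e                     ≤⟨ u≤h≤v⇒u*v≤h*[u+v∸h] c<h (<⇒≤ y₀<e) ⟩
  h * (suc c + e ∸ h)           ≤⟨ degY*m≤edges R y₀ neighbours-large ⟩
  edges R                       ∎
  where
  open ≤-Reasoning
  h = degY R y₀
  c<h : c < h
  c<h = ≰⇒> λ h≤c → <⇒≱ (s≤s (+-monoʳ-≤ c c≤e)) (begin
    suc c + e            ≤⟨ deg x₀ y₀ edge ⟩
    degX R x₀ + h        ≤⟨ +-monoˡ-≤ h x₀≤y₀ ⟩
    h + h                ≤⟨ +-mono-≤ h≤c h≤c ⟩
    c + c                ∎)
  neighbours-large : ∀ x → R x y₀ ≡ true → suc c + e ∸ h ≤ degX R x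
  neighbours-large x edge′ = m≤n+o⇒m∸n≤o (suc c + e) h (≤-trans (deg x y₀ edge′) (≤-reflexive (+-comm (degX R x) h)))

-- The degree-sum bound is written c + e so that deleting a vertex lowers c and keeps e.
small-edge-count⇒small-cover : ∀ c e (R : BipGraph a b) → c ≤ suc e → DegreeSumAtLeast R (c + e) →
  edges R < c * e → HasVertexCoverBelow R c

cover-deleting-heavy-end : ∀ c e (R : BipGraph a b) {x₀ : Fin a} {y₀ : Fin b} → c ≤ e →
  DegreeSumAtLeast R (suc c + e) → edges R < suc c * e → R x₀ y₀ ≡ true → degX R x₀ ≤ degY R y₀ →
  HasVertexCoverBelow R (suc c)

small-edge-count⇒small-cover zero e R _ _ ()
small-edge-count⇒small-cover {a} {b} (suc c) e R c<e deg few with any? (λ x → any? (λ y → R x y Bool.≟ true))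
... | no no-edge =
  ⊥ , ⊥ , (λ x y edge → contradiction (x , y , edge) no-edge) ,
  subst (_< suc c) (sym (cong₂ _+_ (∣⊥∣≡0 a) (∣⊥∣≡0 b))) (s≤s z≤n)
... | yes (x₀ , y₀ , edge) with degX R x₀ ≤? degY R y₀
...   | yes x₀≤y₀ = cover-deleting-heavy-end c e R (s≤s⁻¹ c<e) deg few edge x₀≤y₀
...   | no x₀≰y₀ = HasVertexCoverBelow-flip R
  (cover-deleting-heavy-end c e (flip R) (s≤s⁻¹ c<e)
    (λ y x edge → subst (suc c + e ≤_) (+-comm (degX R x) (degY R y)) (deg x y edge))
    (subst (_< suc c * e) (sym (edges-flip R)) few) edge (≰⇒≥ x₀≰y₀))

cover-deleting-heavy-end c e R {y₀ = y₀} c≤e deg few edge x₀≤y₀ with e ≤? degY R y₀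
... | yes e≤y₀ = HasVertexCoverBelow-deleteY R y₀
  (small-edge-count⇒small-cover c e (deleteY R y₀) (m≤n⇒m≤1+n c≤e) (DegreeSumAtLeast-deleteY R y₀ deg)
    (+-cancelˡ-< e _ _ (begin-strict
      e + edges (deleteY R y₀)           ≤⟨ +-monoˡ-≤ _ e≤y₀ ⟩
      degY R y₀ + edges (deleteY R y₀)   ≡⟨ edges-deleteY R y₀ ⟨
      edges R                            <⟨ few ⟩
      suc c * e                          ∎)))
  where open ≤-Reasoning
... | no e≰y₀ = contradiction few (≤⇒≯ (light-edge⇒many-edges R c≤e deg edge x₀≤y₀ (≰⇒> e≰y₀)))

many-edges⇒complement-cover : (G : BipGraph a b) {r c e : ℕ} → Closed G r → r + (c + e) ≡ suc (a + b) →
  c ≤ suc e → a * b < edges G + c * e → HasVertexCoverBelow (complement G) c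
many-edges⇒complement-cover {a} {b} G {r} {c} {e} closed r+c+e≡ c≤1+e many =
  small-edge-count⇒small-cover c e (complement G) c≤1+e
    (Closed⇒DegreeSumAtLeast-complement G r+c+e≡ closed)
    (+-cancelʳ-< (edges G) _ _ (begin-strict
      edges (complement G) + edges G   ≡⟨ edges-complement G ⟩
      a * b                            <⟨ many ⟩
      edges G + c * e                  ≡⟨ +-comm (edges G) (c * e) ⟩
      c * e + edges G                  ∎))
  where open ≤-Reasoning

Covers-complement⇒Complete : (G : BipGraph a b) {CX : Subset a} {CY : Subset b} →
  Covers (complement G) CX CY → Complete G (∁ CX) (∁ CY)
Covers-complement⇒Complete G covers x y x∈∁CX y∈∁CY with G x y in edge
... | true = refl
... | false = ⊥-elim ([ x∈∁p⇒x∉p x∈∁CX , x∈∁p⇒x∉p y∈∁CY ]′ (covers x y (cong not edge)))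

Covers-complement⇒HasCompleteOfOrder : (G : BipGraph a b) {CX : Subset a} {CY : Subset b} {t : ℕ} →
  Covers (complement G) CX CY → t + (∣ CX ∣ + ∣ CY ∣) ≤ a + b → HasCompleteOfOrder G t
Covers-complement⇒HasCompleteOfOrder {a} {b} G {CX} {CY} {t} covers t+∣C∣≤ =
  let A , B , A⊆ , B⊆ , ∣A∣+∣B∣≡t = ⊆-splitSize (∁ CX) (∁ CY) t≤ in
  A , B , ∣A∣+∣B∣≡t , λ x y x∈A y∈B → Covers-complement⇒Complete G covers x y (A⊆ x∈A) (B⊆ y∈B)
  where
  open ≤-Reasoning
  regroup : ∀ u v w z → u + w + (v + z) ≡ u + v + (w + z)
  regroup = solve-∀
  t≤ : t ≤ ∣ ∁ CX ∣ + ∣ ∁ CY ∣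
  t≤ = +-cancelʳ-≤ (∣ CX ∣ + ∣ CY ∣) t _ (begin
    t + (∣ CX ∣ + ∣ CY ∣)                              ≤⟨ t+∣C∣≤ ⟩
    a + b                                              ≡⟨ cong₂ _+_ (∣∁p∣+∣p∣≡n CX) (∣∁p∣+∣p∣≡n CY) ⟨
    ∣ ∁ CX ∣ + ∣ CX ∣ + (∣ ∁ CY ∣ + ∣ CY ∣)            ≡⟨ regroup (∣ ∁ CX ∣) (∣ ∁ CY ∣) (∣ CX ∣) (∣ CY ∣) ⟩
    ∣ ∁ CX ∣ + ∣ ∁ CY ∣ + (∣ CX ∣ + ∣ CY ∣)            ∎)

s+∣p∣≤n⇒s≤∣∁p∣ : (p : Subset n) {s : ℕ} → s + ∣ p ∣ ≤ n → s ≤ ∣ ∁ p ∣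
s+∣p∣≤n⇒s≤∣∁p∣ p {s} s+∣p∣≤n = +-cancelʳ-≤ ∣ p ∣ s _ (≤-trans s+∣p∣≤n (≤-reflexive (sym (∣∁p∣+∣p∣≡n p))))

Covers-complement⇒HasKXY : (G : BipGraph a b) {CX : Subset a} {CY : Subset b} {s t : ℕ} →
  Covers (complement G) CX CY → s + ∣ CX ∣ ≤ a → t + ∣ CY ∣ ≤ b → HasKXY G s t
Covers-complement⇒HasKXY G {CX} {CY} covers s+∣CX∣≤a t+∣CY∣≤b =
  let A , A⊆ , ∣A∣≡s = ⊆-ofSize (∁ CX) (s+∣p∣≤n⇒s≤∣∁p∣ CX s+∣CX∣≤a)
      B , B⊆ , ∣B∣≡t = ⊆-ofSize (∁ CY) (s+∣p∣≤n⇒s≤∣∁p∣ CY t+∣CY∣≤b) in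
  A , B , ∣A∣≡s , ∣B∣≡t , λ x y x∈A y∈B → Covers-complement⇒Complete G covers x y (A⊆ x∈A) (B⊆ y∈B)

Covers-complement-oneSided : (G : BipGraph a b) {r k q : ℕ} {CX : Subset a} {CY : Subset b} →
  Closed G r → MinDegGE G k → q + r ≤ suc (a + k) →
  Covers (complement G) CX CY → ∣ CX ∣ + ∣ CY ∣ ≤ q →
  Covers (complement G) CX ⊥ ⊎ Covers (complement G) ⊥ CY
Covers-complement-oneSided {a} G {r} {k} {q} {CX} {CY} closed (minDegX , _) q+r≤ covers ∣C∣≤q
  with any? (λ y → ¬? (y ∈? CY) ×-dec any? (λ x → not (G x y) Bool.≟ true))
... | no none = inj₂ λ x y nonedge → inj₂ (y∈CY x y nonedge)
  where
  y∈CY : ∀ x y → not (G x y) ≡ true → y ∈ CY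
  y∈CY x y nonedge with y ∈? CY
  ... | yes y∈CY = y∈CY
  ... | no y∉CY = contradiction (y , y∉CY , x , nonedge) none
... | yes (y , y∉CY , x , nonedge) = inj₁ λ x′ y′ nonedge′ →
  Sum.map₂ (λ y′∈CY → contradiction y′∈CY (∣p∣≡0⇒x∉p ∣CY∣≡0)) (covers x′ y′ nonedge′)
  where
  open ≤-Reasoning
  hY = degY (complement G) y
  dX = degX G x
  dY = degY G y
  hY≤∣CX∣ : hY ≤ ∣ CX ∣
  hY≤∣CX∣ = p⊆q⇒∣p∣≤∣q∣ λ x′∈ →
    [ id , (λ y∈CY → contradiction y∈CY y∉CY) ]′
      (covers _ y (∈-tabulate⁻ (λ x′ → not (G x′ y)) x′∈))
  q≤∣CX∣ : q ≤ ∣ CX ∣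
  q≤∣CX∣ = +-cancelʳ-≤ r q ∣ CX ∣ (begin
    q + r                        ≤⟨ q+r≤ ⟩
    suc (a + k)                  ≡⟨ cong (λ a → suc (a + k)) (∣tabulate-not∣+∣tabulate∣≡n (λ x′ → G x′ y)) ⟨
    suc (hY + dY + k)            ≤⟨ s≤s (+-mono-≤ (+-monoˡ-≤ dY hY≤∣CX∣) (minDegX x)) ⟩
    suc (∣ CX ∣ + dY + dX)       ≡⟨ regroup ∣ CX ∣ dY dX ⟩
    ∣ CX ∣ + suc (dX + dY)       ≤⟨ +-monoʳ-≤ ∣ CX ∣ (closed x y (trans (sym (Bool.not-involutive (G x y))) (cong not nonedge))) ⟩
    ∣ CX ∣ + r                   ∎)
    where
    regroup : ∀ c u v → suc (c + u + v) ≡ c + suc (v + u)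
    regroup = solve-∀
  ∣CY∣≡0 : ∣ CY ∣ ≡ 0
  ∣CY∣≡0 = n≤0⇒n≡0 (+-cancelˡ-≤ ∣ CX ∣ ∣ CY ∣ 0
    (≤-trans ∣C∣≤q (≤-trans q≤∣CX∣ (≤-reflexive (sym (+-identityʳ ∣ CX ∣))))))

Covers-complement⇒HasKXY-oneSided : (G : BipGraph a b) {r k q s t : ℕ} {CX : Subset a} {CY : Subset b} →
  Closed G r → MinDegGE G k → q + r ≤ suc (a + k) →
  Covers (complement G) CX CY → ∣ CX ∣ + ∣ CY ∣ ≤ q → s + q ≤ a → t + q ≤ b →
  HasKXY G s b ⊎ HasKXY G a t
Covers-complement⇒HasKXY-oneSided {a} {b} G {CX = CX} {CY} closed minDeg q+r≤ covers ∣C∣≤q s+q≤a t+q≤b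
  with Covers-complement-oneSided G closed minDeg q+r≤ covers ∣C∣≤q
... | inj₁ coversX = inj₁ (Covers-complement⇒HasKXY G coversX
  (≤-trans (+-monoʳ-≤ _ (≤-trans (m≤m+n ∣ CX ∣ ∣ CY ∣) ∣C∣≤q)) s+q≤a) (n+∣⊥∣≤n b))
... | inj₂ coversY = inj₂ (Covers-complement⇒HasKXY G coversY
  (n+∣⊥∣≤n a) (≤-trans (+-monoʳ-≤ _ (≤-trans (m≤n+m ∣ CY ∣ ∣ CX ∣) ∣C∣≤q)) t+q≤b))

x≡y+z⇒x∸y≡z : ∀ {x} y {z} → x ≡ y + z → x ∸ y ≡ z
x≡y+z⇒x∸y≡z y {z} refl = m+n∸m≡n y z

threshold : ∀ p q → 2 * (p + q) ∸ p + 2 ≡ 2 + (p + (q + q))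
threshold p q = trans (cong (_+ 2) (x≡y+z⇒x∸y≡z p (double p q))) (+-comm (p + (q + q)) 2)
  where
  double : ∀ p q → 2 * (p + q) ≡ p + (p + (q + q))
  double = solve-∀

-- The parametrisation k = p + q, n = 2 + p + 2q + m used in corollary3p1: the complement
-- of G then has degree sums at least c + e = 2q + 1 + m with c = q + 1 and e = q + m.
module _ (p q m : ℕ) where
  private
    N = p + (q + q) + m

  n+p∸k≡2+k+m : 2 + N + p ∸ (p + q) ≡ 2 + (p + q + m)
  n+p∸k≡2+k+m = x≡y+z⇒x∸y≡z (p + q) (identity p q m)
    where
    identity : ∀ p q m → 2 + (p + (q + q) + m) + p ≡ p + q + (2 + (p + q + m))
    identity = solve-∀

  degree-sum-identity : 2 + N + p + 1 + (suc q + (q + m)) ≡ suc (2 + N + suc N)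
  degree-sum-identity = identity p q m
    where
    identity : ∀ p q m → 2 + (p + (q + q) + m) + p + 1 + (suc q + (q + m)) ≡ suc (2 + (p + (q + q) + m) + suc (p + (q + q) + m))
    identity = solve-∀

  complement-edge-identity : (2 + N) * (2 + N + p ∸ (p + q) ∸ 2) + (p + q + 2) * (p + q ∸ p + 1) + suc q * (q + m)
    ≡ (2 + N) * suc N
  complement-edge-identity rewrite n+p∸k≡2+k+m | m+n∸m≡n p q = identity p q m
    where
    identity : ∀ p q m → (2 + (p + (q + q) + m)) * (p + q + m) + (p + q + 2) * (q + 1) + suc q * (q + m)
      ≡ (2 + (p + (q + q) + m)) * suc (p + (q + q) + m)
    identity = solve-∀

  complement-edge-bound : ∀ {E} → (2 + N) * (2 + N + p ∸ (p + q) ∸ 2) + (p + q + 2) * (p + q ∸ p + 1) < E →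
    (2 + N) * suc N < E + suc q * (q + m)
  complement-edge-bound {E} many = subst (_< E + suc q * (q + m)) complement-edge-identity (+-monoˡ-< (suc q * (q + m)) many)

  order-bound : ∀ {c} → c ≤ q → 2 * (2 + N) + p ∸ (p + q) ∸ 1 + c ≤ 2 + N + suc N
  order-bound {c} c≤q =
    subst (λ u → u ∸ 1 + c ≤ 2 + N + suc N) (sym (x≡y+z⇒x∸y≡z (p + q) (expand p q m)))
      (≤-trans (+-monoʳ-≤ _ c≤q) (≤-reflexive (identity p q m)))
    where
    expand : ∀ p q m → 2 * (2 + (p + (q + q) + m)) + p ≡ p + q + suc (suc (p + (q + q) + m + suc (p + suc (q + m))))
    expand = solve-∀
    identity : ∀ p q m → suc (p + (q + q) + m + suc (p + suc (q + m))) + q ≡ 2 + (p + (q + q) + m) + suc (p + (q + q) + m)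
    identity = solve-∀

  min-degree-identity : q + (2 + N + p + 1) ≡ suc (2 + N + (p + q))
  min-degree-identity = identity p q m
    where
    identity : ∀ p q m → q + (2 + (p + (q + q) + m) + p + 1) ≡ suc (2 + (p + (q + q) + m) + (p + q))
    identity = solve-∀

  X-side-identity : 2 + (p + q + m) + q ≡ 2 + N
  X-side-identity = identity p q m
    where
    identity : ∀ p q m → 2 + (p + q + m) + q ≡ 2 + (p + (q + q) + m)
    identity = solve-∀

  Y-side-identity : suc (p + q + m) + q ≡ suc N
  Y-side-identity = cong pred X-side-identity

corollary3p1 : (k p n : ℕ) → p ≤ k → 2 * k ∸ p + 2 ≤ n →
    (G : BipGraph n (n ∸ 1)) →
    Closed G (n + p + 1) →
    n * (n + p ∸ k ∸ 2) + (k + 2) * (k ∸ p + 1) < edges G →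
    HasCompleteOfOrder G (2 * n + p ∸ k ∸ 1)
    × (MinDegGE G k → HasK G (n ∸ 1) (n + p ∸ k) ⊎ HasK G n (n + p ∸ k ∸ 1))
corollary3p1 k p n p≤k n-large G closed many-edges with m≤n⇒∃[o]m+o≡n p≤k
... | q , refl with m≤n⇒∃[o]m+o≡n (subst (_≤ n) (threshold p q) n-large)
... | m , refl
  with many-edges⇒complement-cover G closed (degree-sum-identity p q m) (s≤s (m≤m+n q m))
         (complement-edge-bound p q m many-edges)
... | CX , CY , covers , ∣C∣<1+q rewrite n+p∸k≡2+k+m p q m =
  Covers-complement⇒HasCompleteOfOrder G covers (order-bound p q m (s≤s⁻¹ ∣C∣<1+q)) ,
  λ minDeg → Sum.map inj₂ inj₁ (Covers-complement⇒HasKXY-oneSided G closed minDeg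
    (≤-reflexive (min-degree-identity p q m)) covers (s≤s⁻¹ ∣C∣<1+q)
    (≤-reflexive (X-side-identity p q m)) (≤-reflexive (Y-side-identity p q m)))
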